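{- Let $a\ge1$ and $q\ge1$ be integers. Let $H=(L\cup R,E(H))$ be a bipartite graph with $|L|=|R|=a$ that contains no cycle of length less than $6$ and has the maximum number of edges among such graphs, and let $E_A,E_B\subseteq E(H)$. Let $G$ be the directed graph constructed from $(H,q,E_A,E_B)$ as described below. (1) If $E_A\cap E_B\ne\emptyset$, then the girth of $G$ (length of a shortest directed cycle) is exactly $2q$. (2) If $E_A\cap E_B=\emptyset$, then the girth of $G$ is at least $6q$.
   Context: Construction of $G$: for each $i\in\{1,\dots,q\}$ take a copy $L_i\cup R_i$ of $L\cup R$, writing $l_i$, $r_i$ for the copies of $l\in L$, $r\in R$. For every $r\in R$ add the directed path $r_1\to r_2\to\cdots\to r_q$, and for every $l\in L$ add the directed path $l_q\to l_{q-1}\to\cdots\to l_1$ (pipes). For each edge $\{l,r\}\in E_A$ (with $l\in L$, $r\in R$) add the directed edge $(l_1,r_1)$, and for each $\{l,r\}\in E_B$ add the directed edge $(r_q,l_q)$. Finally add a balanced binary tree $T$ with $q$ leaves $t_1,\dots,t_q$ and height $O(\log q)$, all of whose edges are directed from parent to child, and add a directed edge from every vertex of $L_i\cup R_i$ to $t_i$, for each $i$. The girth is $\infty$ if $G$ has no directed cycle. -}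

module Defs where

open import Data.Nat using (ℕ; zero; suc; _+_; _*_; _∸_; _≤_; _<_)
open import Data.Fin using (Fin; toℕ; inject₁; fromℕ) renaming (zero to fzero; suc to fsuc)
open import Data.Sum using (_⊎_; inj₁; inj₂)
open import Data.Product using (Σ; _×_)
open import Data.Bool using (Bool; true; false; if_then_else_)
open import Data.Nat.ListAction using (sum)
open import Data.List using (List; concatMap; allFin) renaming (map to lmap)
open import Relation.Binary.PropositionalEquality using (_≡_)
open import Function.Definitions using (Injective)
open import Relation.Nullary using (¬_)

record Cycle {V : Set} (Adj : V → V → Set) (k : ℕ) : Set where
  field
    nonempty : 1 ≤ k
    vtx      : Fin (suc k) → V
    closed   : vtx fzero ≡ vtx (fromℕ k)
    steps    : (i : Fin k) → Adj (vtx (inject₁ i)) (vtx (fsuc i))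
    distinct : Injective _≡_ _≡_ (λ (i : Fin k) → vtx (inject₁ i))

-- Bipartite graphs H with parts L = Fin a and R = Fin a.
-- E l r ≡ true  iff  {l , r} is an edge of H  (l ∈ L, r ∈ R).

BipGraph : ℕ → Set
BipGraph a = Fin a → Fin a → Bool

data HAdj {a : ℕ} (E : BipGraph a) : Fin a ⊎ Fin a → Fin a ⊎ Fin a → Set where
  lr : ∀ {l r} → E l r ≡ true → HAdj E (inj₁ l) (inj₂ r)
  rl : ∀ {l r} → E l r ≡ true → HAdj E (inj₂ r) (inj₁ l)

UCycle : ∀ {a} → BipGraph a → ℕ → Set
UCycle E k = (3 ≤ k) × Cycle (HAdj E) k

NoShortCycle : ∀ {a} → BipGraph a → Set
NoShortCycle E = ∀ k → k < 6 → ¬ UCycle E k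

edgeCount : ∀ {a} → BipGraph a → ℕ
edgeCount {a} E =
  sum (concatMap (λ l → lmap (λ r → if E l r then 1 else 0) (allFin a)) (allFin a))

IsExtremal : ∀ {a} → BipGraph a → Set
IsExtremal {a} E = NoShortCycle E × (∀ (E' : BipGraph a) → NoShortCycle E' → edgeCount E' ≤ edgeCount E)

_⊆E_ : ∀ {a} → BipGraph a → BipGraph a → Set
E' ⊆E E = ∀ l r → E' l r ≡ true → E l r ≡ true

-- Layer vertices: layer i (inj₁ l) = l_{i+1}, layer i (inj₂ r) = r_{i+1}
-- (layers indexed 0..q-1 instead of 1..q).
-- Tree vertices: the balanced binary tree in heap numbering, node t : Fin (q + q ∸ 1)
-- carries number toℕ t + 1 ∈ {1,…,2q-1}; node n has children 2n and 2n+1;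
-- the leaves are the nodes q,…,2q-1, and leaf t_{i+1} is node number q + i.
-- (height ⌈log₂ q⌉ = O(log q))

data GV (q a : ℕ) : Set where
  layer : Fin q → Fin a ⊎ Fin a → GV q a
  tree  : Fin (q + q ∸ 1) → GV q a

data GEdge {q a : ℕ} (EA EB : BipGraph a) : GV q a → GV q a → Set where
  pipeR : ∀ {r} {i j : Fin q} → toℕ j ≡ suc (toℕ i) →
          GEdge EA EB (layer i (inj₂ r)) (layer j (inj₂ r))
  pipeL : ∀ {l} {i j : Fin q} → toℕ j ≡ suc (toℕ i) →
          GEdge EA EB (layer j (inj₁ l)) (layer i (inj₁ l))
  edgeA : ∀ {l r} {i : Fin q} → toℕ i ≡ 0 → EA l r ≡ true →
          GEdge EA EB (layer i (inj₁ l)) (layer i (inj₂ r))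
  edgeB : ∀ {l r} {i : Fin q} → suc (toℕ i) ≡ q → EB l r ≡ true →
          GEdge EA EB (layer i (inj₂ r)) (layer i (inj₁ l))
  toLeaf : ∀ {i : Fin q} {v} {t : Fin (q + q ∸ 1)} → suc (toℕ t) ≡ q + toℕ i →
           GEdge EA EB (layer i v) (tree t)
  treeEdge : ∀ {s t : Fin (q + q ∸ 1)} →
             (suc (toℕ t) ≡ 2 * suc (toℕ s)) ⊎ (suc (toℕ t) ≡ suc (2 * suc (toℕ s))) →
             GEdge EA EB (tree s) (tree t)

DirCycle : ∀ {a} (q : ℕ) → BipGraph a → BipGraph a → ℕ → Set
DirCycle {a} q EA EB k = Cycle (GEdge {q} {a} EA EB) k

GirthIs : ∀ {a} (q : ℕ) → BipGraph a → BipGraph a → ℕ → Set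
GirthIs q EA EB g = DirCycle q EA EB g × (∀ k → DirCycle q EA EB k → g ≤ k)

-- girth of G is at least g (vacuously true if G is acyclic, girth = ∞)
GirthAtLeast : ∀ {a} (q : ℕ) → BipGraph a → BipGraph a → ℕ → Set
GirthAtLeast q EA EB g = ∀ k → DirCycle q EA EB k → g ≤ k

{-# OPTIONS --safe #-}
module Submission where

-- A directed cycle never enters the tree T, because tree edges strictly increase the heap index.
-- On the layers every edge advances a phase by one modulo 2q, so the length of every cycle is a
-- multiple of 2q, and a cycle of length 2qm consists of m rounds, each climbing the pipe of some
-- r ∈ R, crossing by an edge {l, r} ∈ E_B, descending the pipe of l and crossing by some
-- {l, r'} ∈ E_A.  A single round closes only if {l, r} ∈ E_A ∩ E_B, and two rounds close only
-- along a 4-cycle l r l' r' of H.  Conversely, for {l, r} ∈ E_A ∩ E_B the pipes of r and l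
-- together form a cycle of length 2q.

open import Defs
open import Data.Nat using (ℕ; zero; suc; _+_; _*_; _∸_; _≤_; _<_; z≤n; s≤s; s≤s⁻¹; z<s; NonZero; _<?_)
open import Data.Nat.Properties
open import Algebra.Properties.CommutativeSemigroup +-commutativeSemigroup using (xy∙z≈xz∙y)
open import Data.Nat.DivMod using (_%_; _/_; _mod_; m≡m%n+[m/n]*n; %-distribˡ-+; m%n%n≡m%n; m%n<n; m<n⇒m%n≡m; n%n≡0; [m+n]%n≡m%n)
open import Data.Nat.Divisibility using (_∣_; divides; ∣m+n∣m⇒∣n; n∣m*n; ∣⇒≤; >⇒∤)
open import Data.Fin using (Fin; toℕ; inject₁; fromℕ; fromℕ<) renaming (zero to fzero; suc to fsuc)
open import Data.Fin.Properties using (toℕ-injective; toℕ<n; toℕ-inject₁; toℕ-fromℕ; toℕ-fromℕ<; fromℕ<-cong; inject₁ℕ<; inject₁-injective)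
open import Data.Sum using (_⊎_; inj₁; inj₂)
open import Data.Sum.Properties using (inj₁-injective; inj₂-injective)
open import Data.Product using (Σ-syntax; ∃₂; _×_; _,_)
open import Data.Bool using (true)
open import Data.Unit using (⊤; tt)
open import Data.Empty using (⊥)
open import Relation.Binary.PropositionalEquality
open import Relation.Binary.Definitions using (tri<; tri≈; tri>)
open import Relation.Nullary using (¬_; contradiction; yes; no)

[m+n]%d≡m%d⇒d∣n : ∀ m n d .{{_ : NonZero d}} → (m + n) % d ≡ m % d → d ∣ n
[m+n]%d≡m%d⇒d∣n m n d eq = ∣m+n∣m⇒∣n (divides ((m + n) / d) (+-cancelˡ-≡ (m % d) _ _ (begin
  m % d + (m / d * d + n)         ≡⟨ +-assoc (m % d) (m / d * d) n ⟨
  m % d + m / d * d + n           ≡⟨ cong (_+ n) (m≡m%n+[m/n]*n m d) ⟨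
  m + n                           ≡⟨ m≡m%n+[m/n]*n (m + n) d ⟩
  (m + n) % d + (m + n) / d * d   ≡⟨ cong (_+ (m + n) / d * d) eq ⟩
  m % d + (m + n) / d * d         ∎))) (n∣m*n (m / d))
  where open ≡-Reasoning

[1+m%d]%d≡[1+m]%d : ∀ m d .{{_ : NonZero d}} → suc (m % d) % d ≡ suc m % d
[1+m%d]%d≡[1+m]%d m d = begin
  (1 + m % d) % d          ≡⟨ %-distribˡ-+ 1 (m % d) d ⟩
  (1 % d + m % d % d) % d  ≡⟨ cong (λ x → (1 % d + x) % d) (m%n%n≡m%n m d) ⟩
  (1 % d + m % d) % d      ≡⟨ %-distribˡ-+ 1 m d ⟨
  (1 + m) % d              ∎
  where open ≡-Reasoning

module CycleWalk {V : Set} {Adj : V → V → Set} {k′ : ℕ} (C : Cycle Adj (suc k′)) where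
  open Cycle C
  private
    k : ℕ
    k = suc k′

  walk : ℕ → V
  walk n = vtx (inject₁ (n mod k))

  private
    vtx≡walk : ∀ i n → toℕ i ≡ n % k → vtx i ≡ walk n
    vtx≡walk i n eq = cong vtx (toℕ-injective (begin
      toℕ i                       ≡⟨ eq ⟩
      n % k                       ≡⟨ toℕ-fromℕ< _ ⟨
      toℕ (n mod k)               ≡⟨ toℕ-inject₁ _ ⟨
      toℕ (inject₁ (n mod k))     ∎))
      where open ≡-Reasoning

  walk-cong : ∀ {m n} → m % k ≡ n % k → walk m ≡ walk n
  walk-cong {m} {n} eq = vtx≡walk (inject₁ (m mod k)) n (trans (toℕ-inject₁ _) (trans (toℕ-fromℕ< _) eq))

  walk-injective : ∀ {m n} → walk m ≡ walk n → m % k ≡ n % k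
  walk-injective e = trans (sym (toℕ-fromℕ< _)) (trans (cong toℕ (distinct e)) (toℕ-fromℕ< _))

  walk-periodic : ∀ n → walk (n + k) ≡ walk n
  walk-periodic n = walk-cong {n + k} {n} ([m+n]%n≡m%n n k)

  walk-apart : ∀ m d .{{_ : NonZero d}} → d < k → walk m ≢ walk (m + d)
  walk-apart m d d<k e = >⇒∤ d<k ([m+n]%d≡m%d⇒d∣n m d k (sym (walk-injective {m} {m + d} e)))

  walk-step : ∀ n → Adj (walk n) (walk (suc n))
  walk-step n = subst (Adj (walk n)) (successor (m≤n⇒m<n∨m≡n (m%n<n n k))) (steps (n mod k))
    where
      open ≡-Reasoning
      toℕ-suc : toℕ (fsuc (n mod k)) ≡ suc (n % k)
      toℕ-suc = cong suc (toℕ-fromℕ< _)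

      successor : suc (n % k) < k ⊎ suc (n % k) ≡ k → vtx (fsuc (n mod k)) ≡ walk (suc n)
      successor (inj₁ lt) = vtx≡walk _ (suc n) (begin
        toℕ (fsuc (n mod k))   ≡⟨ toℕ-suc ⟩
        suc (n % k)            ≡⟨ m<n⇒m%n≡m lt ⟨
        suc (n % k) % k        ≡⟨ [1+m%d]%d≡[1+m]%d n k ⟩
        suc n % k              ∎)
      successor (inj₂ wraps) = begin
        vtx (fsuc (n mod k))   ≡⟨ cong vtx (toℕ-injective (trans toℕ-suc (trans wraps (sym (toℕ-fromℕ k))))) ⟩
        vtx (fromℕ k)          ≡⟨ closed ⟨
        vtx fzero              ≡⟨ vtx≡walk fzero (suc n) (begin
                                    0                 ≡⟨ n%n≡0 k ⟨
                                    k % k             ≡⟨ cong (_% k) wraps ⟨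
                                    suc (n % k) % k   ≡⟨ [1+m%d]%d≡[1+m]%d n k ⟩
                                    suc n % k         ∎) ⟩
        walk (suc n)           ∎

walk⇒cycle : ∀ {V : Set} {Adj : V → V → Set} {k} (W : ℕ → V) → 1 ≤ k →
             (∀ n → n < k → Adj (W n) (W (suc n))) → W 0 ≡ W k →
             (∀ {m n} → m < k → n < k → W m ≡ W n → m ≡ n) → Cycle Adj k
walk⇒cycle {Adj = Adj} {k} W k≥1 step closes injective = record
  { nonempty = k≥1
  ; vtx      = λ i → W (toℕ i)
  ; closed   = trans closes (cong W (sym (toℕ-fromℕ k)))
  ; steps    = λ i → subst (λ m → Adj (W m) (W (suc (toℕ i)))) (sym (toℕ-inject₁ i)) (step (toℕ i) (toℕ<n i))
  ; distinct = λ {i} {j} e → inject₁-injective (toℕ-injective (injective (inject₁ℕ< i) (inject₁ℕ< j) e))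
  }

module _ {V : Set} {Adj : V → V → Set} (P : V → Set) (rank : V → ℕ)
         (ascends : ∀ {v w} → P v → Adj v w → P w × rank v < rank w)
         (W : ℕ → V) (step : ∀ n → Adj (W n) (W (suc n))) where

  rank-grows : ∀ {n} → P (W n) → ∀ j → P (W (n + j)) × rank (W n) + j ≤ rank (W (n + j))
  rank-grows {n} p zero rewrite +-identityʳ n = p , ≤-reflexive (+-identityʳ _)
  rank-grows {n} p (suc j) rewrite +-suc n j with rank-grows p j
  ... | pj , grown with ascends pj (step (n + j))
  ... | pj+1 , lt = pj+1 , ≤-trans (≤-reflexive (+-suc _ j)) (≤-trans (s≤s grown) lt)

  closed-walk-avoids : ∀ {k n} → 0 < k → W (n + k) ≡ W n → ¬ P (W n)
  closed-walk-avoids {k} {n} k>0 closes p with rank-grows p k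
  ... | _ , grown = <-irrefl refl (<-≤-trans (m<m+n _ k>0) (subst (λ v → rank (W n) + k ≤ rank v) closes grown))

four-cycle : ∀ {a} (E : BipGraph a) {l₁ l₂ r₁ r₂ : Fin a} → l₁ ≢ l₂ → r₁ ≢ r₂ →
             E l₁ r₁ ≡ true → E l₂ r₁ ≡ true → E l₂ r₂ ≡ true → E l₁ r₂ ≡ true → UCycle E 4
four-cycle E {l₁} {l₂} {r₁} {r₂} l₁≢l₂ r₁≢r₂ e₁₁ e₂₁ e₂₂ e₁₂ = s≤s (s≤s (s≤s z≤n)) , record
  { nonempty = s≤s z≤n ; vtx = vtx ; closed = refl ; steps = steps ; distinct = distinct }
  where
    vtx : Fin 5 → Fin _ ⊎ Fin _
    vtx fzero                                = inj₁ l₁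
    vtx (fsuc fzero)                         = inj₂ r₁
    vtx (fsuc (fsuc fzero))                  = inj₁ l₂
    vtx (fsuc (fsuc (fsuc fzero)))           = inj₂ r₂
    vtx (fsuc (fsuc (fsuc (fsuc fzero))))    = inj₁ l₁

    steps : (i : Fin 4) → HAdj E (vtx (inject₁ i)) (vtx (fsuc i))
    steps fzero                      = lr e₁₁
    steps (fsuc fzero)               = rl e₂₁
    steps (fsuc (fsuc fzero))        = lr e₂₂
    steps (fsuc (fsuc (fsuc fzero))) = rl e₁₂

    distinct : ∀ {i j : Fin 4} → vtx (inject₁ i) ≡ vtx (inject₁ j) → i ≡ j
    distinct {fzero}                      {fzero}                      _ = refl
    distinct {fsuc fzero}                 {fsuc fzero}                 _ = refl
    distinct {fsuc (fsuc fzero)}          {fsuc (fsuc fzero)}          _ = refl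
    distinct {fsuc (fsuc (fsuc fzero))}   {fsuc (fsuc (fsuc fzero))}   _ = refl
    distinct {fzero}                      {fsuc (fsuc fzero)}          e = contradiction (inj₁-injective e) l₁≢l₂
    distinct {fsuc (fsuc fzero)}          {fzero}                      e = contradiction (inj₁-injective (sym e)) l₁≢l₂
    distinct {fsuc fzero}                 {fsuc (fsuc (fsuc fzero))}   e = contradiction (inj₂-injective e) r₁≢r₂
    distinct {fsuc (fsuc (fsuc fzero))}   {fsuc fzero}                 e = contradiction (inj₂-injective (sym e)) r₁≢r₂
    distinct {fzero}                      {fsuc fzero}                 ()
    distinct {fzero}                      {fsuc (fsuc (fsuc fzero))}   ()
    distinct {fsuc fzero}                 {fzero}                      ()
    distinct {fsuc fzero}                 {fsuc (fsuc fzero)}          ()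
    distinct {fsuc (fsuc fzero)}          {fsuc fzero}                 ()
    distinct {fsuc (fsuc fzero)}          {fsuc (fsuc (fsuc fzero))}   ()
    distinct {fsuc (fsuc (fsuc fzero))}   {fzero}                      ()
    distinct {fsuc (fsuc (fsuc fzero))}   {fsuc (fsuc fzero)}          ()

module _ {q′ a : ℕ} where
  private
    q N : ℕ
    q = suc q′
    N = q + q

  InTree : GV q a → Set
  InTree (layer _ _) = ⊥
  InTree (tree _)    = ⊤

  tree-rank : GV q a → ℕ
  tree-rank (layer _ _) = 0
  tree-rank (tree t)    = toℕ t

  tree-ascends : ∀ {EA EB : BipGraph a} {v w} → InTree v → GEdge EA EB v w → InTree w × tree-rank v < tree-rank w
  tree-ascends {v = layer _ _} ()
  tree-ascends {v = tree _} _ (treeEdge {s} (inj₁ e)) = tt , subst (toℕ s <_) (sym (suc-injective e)) (m<m+n (toℕ s) z<s)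
  tree-ascends {v = tree _} _ (treeEdge {s} (inj₂ e)) = tt , subst (toℕ s <_) (sym (suc-injective e)) (s≤s (m≤m+n (toℕ s) _))

  layer-injectiveʳ : ∀ {i j : Fin q} {x y : Fin a ⊎ Fin a} → layer {q} {a} i x ≡ layer j y → x ≡ y
  layer-injectiveʳ refl = refl

  -- Away from the tree, G is a blow-up of the directed cycle of length 2q: with r_i at phase i - 1
  -- and l_i at phase 2q - i, every edge goes from phase p to phase p + 1 mod 2q.
  phase : GV q a → ℕ
  phase (layer i (inj₂ _)) = toℕ i
  phase (layer i (inj₁ _)) = q + (q′ ∸ toℕ i)
  phase (tree _)           = 0

  phase<2q : ∀ v → ¬ InTree v → phase v < N
  phase<2q (layer i (inj₂ _)) _ = <-≤-trans (toℕ<n i) (m≤m+n q q)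
  phase<2q (layer i (inj₁ _)) _ = +-monoʳ-< q (s≤s (m∸n≤m q′ (toℕ i)))
  phase<2q (tree _) off = contradiction tt off

  phase-succ : ∀ {EA EB : BipGraph a} {v w} → GEdge EA EB v w → ¬ InTree w →
               phase w ≡ suc (phase v) ⊎ (suc (phase v) ≡ N × phase w ≡ 0)
  phase-succ (pipeR e) _ = inj₁ e
  phase-succ (pipeL {i = i} {j} e) _ = inj₁ (begin
    q + (q′ ∸ toℕ i)             ≡⟨ cong (q +_) (+-∸-assoc 1 (s≤s⁻¹ (subst (_< q) e (toℕ<n j)))) ⟩
    q + suc (q′ ∸ suc (toℕ i))   ≡⟨ +-suc q _ ⟩
    suc (q + (q′ ∸ suc (toℕ i))) ≡⟨ cong (λ h → suc (q + (q′ ∸ h))) e ⟨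
    suc (q + (q′ ∸ toℕ j))       ∎)
    where open ≡-Reasoning
  phase-succ (edgeA z _) _ rewrite z = inj₂ (sym (+-suc q q′) , refl)
  phase-succ (edgeB top _) _ rewrite suc-injective top =
    inj₁ (trans (cong (q +_) (n∸n≡0 q′)) (+-identityʳ q))
  phase-succ (toLeaf _) off = contradiction tt off
  phase-succ (treeEdge _) off = contradiction tt off

  phase-step : ∀ {EA EB : BipGraph a} {v w} → GEdge EA EB v w → ¬ InTree w → phase w ≡ suc (phase v) % N
  phase-step {w = w} e off with phase-succ e off
  ... | inj₁ up = trans up (sym (m<n⇒m%n≡m (subst (_< N) up (phase<2q w off))))
  ... | inj₂ (wraps , at-0) = trans at-0 (sym (trans (cong (_% N) wraps) (n%n≡0 N)))

  phase≡0⇒bottom : ∀ v → ¬ InTree v → phase v ≡ 0 → Σ[ r ∈ Fin a ] v ≡ layer fzero (inj₂ r)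
  phase≡0⇒bottom (layer fzero (inj₂ r)) _ _ = r , refl
  phase≡0⇒bottom (tree _) off _ = contradiction tt off

  module _ {EA EB : BipGraph a} where
    pipe-up : ∀ {i : Fin q} {r w} → GEdge EA EB (layer i (inj₂ r)) w → ¬ InTree w → suc (toℕ i) < q →
              Σ[ j ∈ Fin q ] toℕ j ≡ suc (toℕ i) × w ≡ layer j (inj₂ r)
    pipe-up (pipeR e) _ _ = _ , e , refl
    pipe-up (edgeB top _) _ below = contradiction top (<⇒≢ below)
    pipe-up (toLeaf _) off _ = contradiction tt off

    cross-top : ∀ {i : Fin q} {r w} → GEdge EA EB (layer i (inj₂ r)) w → ¬ InTree w → suc (toℕ i) ≡ q →
                Σ[ l ∈ Fin a ] EB l r ≡ true × w ≡ layer i (inj₁ l)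
    cross-top (pipeR {j = j} e) _ top = contradiction (trans e top) (<⇒≢ (toℕ<n j))
    cross-top (edgeB _ eb) _ _ = _ , eb , refl
    cross-top (toLeaf _) off _ = contradiction tt off

    pipe-down : ∀ {j : Fin q} {l w} → GEdge EA EB (layer j (inj₁ l)) w → ¬ InTree w → 0 < toℕ j →
                Σ[ i ∈ Fin q ] suc (toℕ i) ≡ toℕ j × w ≡ layer i (inj₁ l)
    pipe-down (pipeL e) _ _ = _ , sym e , refl
    pipe-down (edgeA bottom _) _ above = contradiction (sym bottom) (<⇒≢ above)
    pipe-down (toLeaf _) off _ = contradiction tt off

    cross-bottom : ∀ {l w} → GEdge EA EB (layer fzero (inj₁ l)) w → ¬ InTree w →
                   Σ[ r ∈ Fin a ] EA l r ≡ true × w ≡ layer fzero (inj₂ r)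
    cross-bottom (edgeA _ ea) _ = _ , ea , refl
    cross-bottom (toLeaf _) off = contradiction tt off

    module _ {k′ : ℕ} (C : DirCycle q EA EB (suc k′)) where
      open CycleWalk C
      private
        k : ℕ
        k = suc k′

      off-tree : ∀ n → ¬ InTree (walk n)
      off-tree n = closed-walk-avoids InTree tree-rank tree-ascends walk walk-step {k} {n} z<s (walk-periodic n)

      private
        edge-from : ∀ n {v} → walk n ≡ v → GEdge EA EB v (walk (suc n))
        edge-from n e = subst (λ u → GEdge EA EB u (walk (suc n))) e (walk-step n)

        p₀ : ℕ
        p₀ = phase (walk 0)

        p₀<2q : p₀ < N
        p₀<2q = phase<2q _ (off-tree 0)

      phase-walk : ∀ n → phase (walk n) ≡ (p₀ + n) % N
      phase-walk zero = sym (trans (cong (_% N) (+-identityʳ p₀)) (m<n⇒m%n≡m p₀<2q))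
      phase-walk (suc n) = begin
        phase (walk (suc n))       ≡⟨ phase-step (walk-step n) (off-tree (suc n)) ⟩
        suc (phase (walk n)) % N   ≡⟨ cong (λ x → suc x % N) (phase-walk n) ⟩
        suc ((p₀ + n) % N) % N     ≡⟨ [1+m%d]%d≡[1+m]%d (p₀ + n) N ⟩
        suc (p₀ + n) % N           ≡⟨ cong (_% N) (+-suc p₀ n) ⟨
        (p₀ + suc n) % N           ∎
        where open ≡-Reasoning

      length-multiple : N ∣ k
      length-multiple = [m+n]%d≡m%d⇒d∣n p₀ k N (begin
        (p₀ + k) % N     ≡⟨ phase-walk k ⟨
        phase (walk k)   ≡⟨ cong phase (walk-periodic 0) ⟩
        p₀               ≡⟨ m<n⇒m%n≡m p₀<2q ⟨
        p₀ % N           ∎)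
        where open ≡-Reasoning

      bottom-vertex : Σ[ s ∈ ℕ ] Σ[ r ∈ Fin a ] walk s ≡ layer fzero (inj₂ r)
      bottom-vertex = N ∸ p₀ , phase≡0⇒bottom (walk (N ∸ p₀)) (off-tree (N ∸ p₀)) (begin
        phase (walk (N ∸ p₀))   ≡⟨ phase-walk (N ∸ p₀) ⟩
        (p₀ + (N ∸ p₀)) % N     ≡⟨ cong (_% N) (m+[n∸m]≡n (<⇒≤ p₀<2q)) ⟩
        N % N                   ≡⟨ n%n≡0 N ⟩
        0                       ∎)
        where open ≡-Reasoning

      climb : ∀ h n {r} (i : Fin q) → toℕ i + h ≡ q′ → walk n ≡ layer i (inj₂ r) →
              walk (n + h) ≡ layer (fromℕ q′) (inj₂ r)
      climb zero n i reaches e =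
        trans (cong walk (+-identityʳ n)) (subst (λ j → walk n ≡ layer j _) i≡top e)
        where
          i≡top : i ≡ fromℕ q′
          i≡top = toℕ-injective (trans (sym (+-identityʳ _)) (trans reaches (sym (toℕ-fromℕ q′))))
      climb (suc h) n i reaches e
        with pipe-up (edge-from n e) (off-tree (suc n)) (s≤s (subst (toℕ i <_) reaches (m<m+n (toℕ i) z<s)))
      ... | j , j≡i+1 , e′ =
        trans (cong walk (+-suc n h)) (climb h (suc n) j (trans (cong (_+ h) j≡i+1) (trans (sym (+-suc (toℕ i) h)) reaches)) e′)

      descend : ∀ h n {l} (i : Fin q) → toℕ i ≡ h → walk n ≡ layer i (inj₁ l) →
                walk (n + h) ≡ layer fzero (inj₁ l)
      descend zero n fzero _ e = trans (cong walk (+-identityʳ n)) e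
      descend (suc h) n i height e with pipe-down (edge-from n e) (off-tree (suc n)) (subst (0 <_) (sym height) z<s)
      ... | j , i≡j+1 , e′ = trans (cong walk (+-suc n h)) (descend h (suc n) j (suc-injective (trans i≡j+1 height)) e′)

      record Round (s : ℕ) (r : Fin a) : Set where
        field
          l r′      : Fin a
          EB-lr     : EB l r ≡ true
          EA-lr′    : EA l r′ ≡ true
          at-top    : walk (s + q) ≡ layer (fromℕ q′) (inj₁ l)
          at-bottom : walk (s + N) ≡ layer fzero (inj₂ r′)

      round : ∀ {s r} → walk s ≡ layer fzero (inj₂ r) → Round s r
      round {s} at-s =
        let l , eb , top = cross-top (edge-from (s + q′) (climb q′ s fzero refl at-s)) (off-tree (suc (s + q′))) (cong suc (toℕ-fromℕ q′))
            at-top = trans (cong walk (+-suc s q′)) top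
            r′ , ea , bottom = cross-bottom (edge-from (s + q + q′) (descend q′ (s + q) (fromℕ q′) (toℕ-fromℕ q′) at-top))
                                    (off-tree (suc (s + q + q′)))
        in record { l = l ; r′ = r′ ; EB-lr = eb ; EA-lr′ = ea ; at-top = at-top
                  ; at-bottom = trans (cong walk (trans (sym (+-assoc s q q)) (+-suc (s + q) q′))) bottom }

      length≢2q : ¬ (∃₂ λ l r → EA l r ≡ true × EB l r ≡ true) → k ≢ N
      length≢2q disjoint k≡2q with bottom-vertex
      ... | s , r , at-s = disjoint (l , r , subst (λ x → EA l x ≡ true) r′≡r EA-lr′ , EB-lr)
        where
          open Round (round {s} at-s)
          r′≡r : r′ ≡ r
          r′≡r = inj₂-injective (layer-injectiveʳ (begin
            layer fzero (inj₂ r′)  ≡⟨ at-bottom ⟨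
            walk (s + N)           ≡⟨ cong (λ m → walk (s + m)) k≡2q ⟨
            walk (s + k)           ≡⟨ walk-periodic s ⟩
            walk s                 ≡⟨ at-s ⟩
            layer fzero (inj₂ r)   ∎))
            where open ≡-Reasoning

      length≢4q : ∀ {E} → NoShortCycle E → EA ⊆E E → EB ⊆E E → k ≢ N + N
      length≢4q {E} no-short EA⊆E EB⊆E k≡4q with bottom-vertex
      ... | s , r₁ , at-s =
        no-short 4 (s≤s (s≤s (s≤s (s≤s (s≤s z≤n)))))
          (four-cycle E l₁≢l₂ r₁≢r₂ (EB⊆E _ _ R₁.EB-lr) (EA⊆E _ _ (subst (λ x → EA R₂.l x ≡ true) r₃≡r₁ R₂.EA-lr′))
                                   (EB⊆E _ _ R₂.EB-lr) (EA⊆E _ _ R₁.EA-lr′))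
        where
          open ≡-Reasoning
          module R₁ = Round (round {s} at-s)
          module R₂ = Round (round {s + N} R₁.at-bottom)

          2q<k : N < k
          2q<k = subst (N <_) (sym k≡4q) (m<m+n N z<s)

          r₃≡r₁ : R₂.r′ ≡ r₁
          r₃≡r₁ = inj₂-injective (layer-injectiveʳ (begin
            layer fzero (inj₂ R₂.r′)  ≡⟨ R₂.at-bottom ⟨
            walk (s + N + N)          ≡⟨ cong walk (+-assoc s N N) ⟩
            walk (s + (N + N))        ≡⟨ cong (λ m → walk (s + m)) k≡4q ⟨
            walk (s + k)              ≡⟨ walk-periodic s ⟩
            walk s                    ≡⟨ at-s ⟩
            layer fzero (inj₂ r₁)     ∎))

          r₁≢r₂ : r₁ ≢ R₁.r′
          r₁≢r₂ r₁≡r₂ = walk-apart s N 2q<k (begin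
            walk s                    ≡⟨ at-s ⟩
            layer fzero (inj₂ r₁)     ≡⟨ cong (λ x → layer fzero (inj₂ x)) r₁≡r₂ ⟩
            layer fzero (inj₂ R₁.r′)  ≡⟨ R₁.at-bottom ⟨
            walk (s + N)              ∎)

          l₁≢l₂ : R₁.l ≢ R₂.l
          l₁≢l₂ l₁≡l₂ = walk-apart (s + q) N 2q<k (begin
            walk (s + q)                       ≡⟨ R₁.at-top ⟩
            layer (fromℕ q′) (inj₁ R₁.l)       ≡⟨ cong (λ x → layer (fromℕ q′) (inj₁ x)) l₁≡l₂ ⟩
            layer (fromℕ q′) (inj₁ R₂.l)       ≡⟨ R₂.at-top ⟨
            walk (s + N + q)                   ≡⟨ cong walk (xy∙z≈xz∙y s N q) ⟩
            walk (s + q + N)                   ∎)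

    module _ {l r : Fin a} (ea : EA l r ≡ true) (eb : EB l r ≡ true) where
      private
        down : ℕ → Fin q
        down n = fromℕ< (s≤s (m∸n≤m q′ (n ∸ q)))

      loop : ℕ → GV q a
      loop n with n <? q | n <? N
      ... | yes n<q | _     = layer (fromℕ< n<q) (inj₂ r)
      ... | no _    | yes _ = layer (down n) (inj₁ l)
      ... | no _    | no _  = layer fzero (inj₂ r)

      loop-up : ∀ {n} (n<q : n < q) → loop n ≡ layer (fromℕ< n<q) (inj₂ r)
      loop-up {n} n<q with n <? q | n <? N
      ... | yes _  | _ = refl
      ... | no n≮q | _ = contradiction n<q n≮q

      loop-down : ∀ {n} → q ≤ n → n < N → loop n ≡ layer (down n) (inj₁ l)
      loop-down {n} q≤n n<2q with n <? q | n <? N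
      ... | yes n<q | _       = contradiction n<q (≤⇒≯ q≤n)
      ... | no _    | yes _   = refl
      ... | no _    | no n≮2q = contradiction n<2q n≮2q

      loop-end : loop N ≡ layer fzero (inj₂ r)
      loop-end with N <? q | N <? N
      ... | yes 2q<q | _     = contradiction 2q<q (≤⇒≯ (m≤m+n q q))
      ... | no _     | yes 2q<2q = contradiction 2q<2q (<-irrefl refl)
      ... | no _     | no _  = refl

      phase-loop : ∀ {n} → n < N → phase (loop n) ≡ n
      phase-loop {n} n<2q with <-≤-connex n q
      ... | inj₁ n<q = trans (cong phase (loop-up n<q)) (toℕ-fromℕ< _)
      ... | inj₂ q≤n = trans (cong phase (loop-down q≤n n<2q)) (begin
        q + (q′ ∸ toℕ (down n))      ≡⟨ cong (λ i → q + (q′ ∸ i)) (toℕ-fromℕ< (s≤s (m∸n≤m q′ (n ∸ q)))) ⟩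
        q + (q′ ∸ (q′ ∸ (n ∸ q)))    ≡⟨ cong (q +_) (m∸[m∸n]≡n (s≤s⁻¹ (m<n+o⇒m∸n<o n q n<2q))) ⟩
        q + (n ∸ q)                  ≡⟨ m+[n∸m]≡n q≤n ⟩
        n                            ∎)
        where open ≡-Reasoning

      loop-edge : ∀ n → n < N → GEdge EA EB (loop n) (loop (suc n))
      loop-edge n n<2q with <-cmp (suc n) q
      ... | tri< n+1<q _ _ =
        subst₂ (GEdge EA EB) (sym (loop-up n<q)) (sym (loop-up n+1<q))
               (pipeR (trans (toℕ-fromℕ< n+1<q) (cong suc (sym (toℕ-fromℕ< n<q)))))
        where
          n<q : n < q
          n<q = <-trans (n<1+n n) n+1<q
      ... | tri≈ _ refl _ =
        subst₂ (GEdge EA EB) (sym (loop-up ≤-refl)) (sym (loop-down ≤-refl (m<m+n q z<s)))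
               (subst (λ i → GEdge EA EB (layer top (inj₂ r)) (layer i (inj₁ l))) top≡down (edgeB (cong suc (toℕ-fromℕ< _)) eb))
        where
          top : Fin q
          top = fromℕ< ≤-refl
          top≡down : top ≡ down q
          top≡down = fromℕ<-cong q′ (q′ ∸ (q ∸ q)) (cong (q′ ∸_) (sym (n∸n≡0 q′))) _ _
      ... | tri> _ _ q<n+1 with m≤n⇒m<n∨m≡n n<2q
      ...   | inj₁ n+1<2q =
        subst₂ (GEdge EA EB) (sym (loop-down q≤n n<2q)) (sym (loop-down (≤-trans q≤n (n≤1+n n)) n+1<2q)) (pipeL (begin
          toℕ (down n)                 ≡⟨ toℕ-fromℕ< _ ⟩
          q′ ∸ (n ∸ q)                 ≡⟨ +-∸-assoc 1 (subst (_≤ q′) n+1∸q≡ (s≤s⁻¹ (m<n+o⇒m∸n<o (suc n) q n+1<2q))) ⟩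
          suc (q′ ∸ suc (n ∸ q))       ≡⟨ cong (λ x → suc (q′ ∸ x)) n+1∸q≡ ⟨
          suc (q′ ∸ (suc n ∸ q))       ≡⟨ cong suc (toℕ-fromℕ< _) ⟨
          suc (toℕ (down (suc n)))     ∎))
        where
          open ≡-Reasoning
          q≤n = s≤s⁻¹ q<n+1
          n+1∸q≡ : suc n ∸ q ≡ suc (n ∸ q)
          n+1∸q≡ = +-∸-assoc 1 q≤n
      ...   | inj₂ refl =
        subst₂ (GEdge EA EB) (sym (loop-down (s≤s⁻¹ q<n+1) n<2q)) (sym loop-end)
               (subst (λ i → GEdge EA EB (layer i (inj₁ l)) (layer fzero (inj₂ r))) (sym down≡0) (edgeA refl ea))
        where
          down≡0 : down n ≡ fzero
          down≡0 = toℕ-injective (trans (toℕ-fromℕ< _) (trans (cong (q′ ∸_) (m+n∸n≡m q′ q)) (n∸n≡0 q′)))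

      loop-cycle : DirCycle q EA EB N
      loop-cycle = walk⇒cycle loop (s≤s z≤n) loop-edge (trans (loop-up z<s) (sym loop-end))
        λ m<2q n<2q e → trans (sym (phase-loop m<2q)) (trans (cong phase e) (phase-loop n<2q))

3*d≤multiple : ∀ {d k} → d ∣ k → k ≢ 0 → k ≢ d → k ≢ d + d → 3 * d ≤ k
3*d≤multiple (divides 0 k≡0) k≢0 _ _ = contradiction k≡0 k≢0
3*d≤multiple {d} (divides 1 k≡d) _ k≢d _ = contradiction (trans k≡d (+-identityʳ d)) k≢d
3*d≤multiple {d} (divides 2 k≡2d) _ _ k≢2d = contradiction (trans k≡2d (cong (d +_) (+-identityʳ d))) k≢2d
3*d≤multiple {d} (divides (suc (suc (suc m))) k≡md) _ _ _ =
  subst (3 * d ≤_) (sym k≡md) (*-monoˡ-≤ d {3} {suc (suc (suc m))} (s≤s (s≤s (s≤s z≤n))))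

cycle-length≥2q : ∀ {q′ a k} {EA EB : BipGraph a} → DirCycle (suc q′) EA EB k → suc q′ + suc q′ ≤ k
cycle-length≥2q {k = zero} C = contradiction (Cycle.nonempty C) λ ()
cycle-length≥2q {k = suc _} C = ∣⇒≤ (length-multiple C)

cycle-length≥6q : ∀ {q′ a k} {E EA EB : BipGraph a} → NoShortCycle E → EA ⊆E E → EB ⊆E E →
                  ¬ (∃₂ λ l r → EA l r ≡ true × EB l r ≡ true) →
                  DirCycle (suc q′) EA EB k → 3 * (suc q′ + suc q′) ≤ k
cycle-length≥6q {k = zero} _ _ _ _ C = contradiction (Cycle.nonempty C) λ ()
cycle-length≥6q {k = suc _} no-short EA⊆E EB⊆E disjoint C =
  3*d≤multiple (length-multiple C) (λ ()) (length≢2q C disjoint) (length≢4q C no-short EA⊆E EB⊆E)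

claim19 : (a q : ℕ) → 1 ≤ a → 1 ≤ q →
    (E : BipGraph a) → IsExtremal E →
    (EA EB : BipGraph a) → EA ⊆E E → EB ⊆E E →
    ((∃₂ λ l r → EA l r ≡ true × EB l r ≡ true) → GirthIs q EA EB (2 * q))
    × ((¬ (∃₂ λ l r → EA l r ≡ true × EB l r ≡ true)) → GirthAtLeast q EA EB (6 * q))
claim19 _ zero _ ()
claim19 a (suc q′) _ _ E (no-short , _) EA EB EA⊆E EB⊆E =
  (λ (_ , _ , ea , eb) → subst (DirCycle q EA EB) (sym 2q≡q+q) (loop-cycle ea eb) ,
                         λ k C → subst (_≤ k) (sym 2q≡q+q) (cycle-length≥2q C)) ,
  (λ disjoint k C → subst (_≤ k) (sym 6q≡3[q+q]) (cycle-length≥6q no-short EA⊆E EB⊆E disjoint C))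
  where
    q = suc q′
    2q≡q+q : 2 * q ≡ q + q
    2q≡q+q = cong (q +_) (+-identityʳ q)
    6q≡3[q+q] : 6 * q ≡ 3 * (q + q)
    6q≡3[q+q] = trans (*-assoc 3 2 q) (cong (3 *_) 2q≡q+q)
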